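{- Let $q=p^m$ with $p$ an odd prime, $q\equiv 1\pmod 3$ and $q\ge 13$. (a) Let $\pi,\sigma\in PGL(2,q)$ with $\pi(x)=a+\frac{r}{x-i}$, $\sigma(x)=b+\frac{s}{x-j}$, where $a,b,i,j,r,s\in GF(q)$ and $r,s\neq0$. Then $\pi\sigma\in E(C_P(q))$ if and only if $r=s$ and $(b-a)(j-i)=r$. (b) An element $\pi\in PGL(2,q)$ is an isolated vertex of $C_P(q)$ if and only if $\pi(\infty)=\infty$.
   Context: $PGL(2,q)$ is the group of maps $x\mapsto\frac{ax+b}{cx+d}$ ($ad\neq bc$) acting on $GF(q)\cup\{\infty\}$ with the usual conventions ($-d/c\mapsto\infty$, $\infty\mapsto a/c$ if $c\neq0$, $\infty\mapsto\infty$ if $c=0$). The function $a+\frac{r}{x-i}$ ($r\ne0$) maps $x\notin\{i,\infty\}$ to $a+r(x-i)^{ -1}$, $\infty\mapsto a$, $i\mapsto\infty$. For permutations $\pi,\sigma$, $hd(\pi,\sigma)=|\{x:\pi(x)\neq\sigma(x)\}|$. With distinguished element $\infty$, $\pi^{\triangle}$ is defined by $\pi^{\triangle}(\pi^{ -1}(\infty))=\pi(\infty)$, $\pi^{\triangle}(\infty)=\infty$, $\pi^{\triangle}(x)=\pi(x)$ otherwise. The contraction graph $C_P(q)$ has vertex set $PGL(2,q)$, with distinct $\pi,\sigma$ adjacent iff $hd(\pi^{\triangle},\sigma^{\triangle})=q-4$. -}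

module Defs where

open import Data.Nat as ℕ using (ℕ)
open import Data.Fin using (Fin)
open import Data.List using (List; _∷_; map; filter; length; allFin)
open import Data.Product using (Σ; ∃; _×_; _,_)
open import Relation.Binary.PropositionalEquality using (_≡_; _≢_; refl)
open import Relation.Binary.Definitions using (DecidableEquality)
open import Relation.Nullary using (¬_; Dec; yes; no; ¬?)
open import Algebra.Structures using (IsCommutativeRing)
open import Function.Bundles using (Inverse; _↔_)
open import Function using (_∘_)

-- Any such field is GF(q).
record FiniteField (q : ℕ) : Set₁ where
  infixl 6 _+_ _-_
  infixl 7 _*_
  field
    F    : Set
    _+_  : F → F → F
    _*_  : F → F → F
    -_   : F → F
    0#   : F
    1#   : F
    _⁻¹  : F → F
    isCommutativeRing : IsCommutativeRing _≡_ _+_ _*_ -_ 0# 1#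
    0≢1  : 0# ≢ 1#
    inverseʳ : ∀ x → x ≢ 0# → x * (x ⁻¹) ≡ 1#
    _≟_  : DecidableEquality F
    enum : Fin q ↔ F

  _-_ : F → F → F
  x - y = x + (- y)

module PGL {q : ℕ} (K : FiniteField q) where
  open FiniteField K

  data Pt : Set where
    fin : F → Pt
    ∞   : Pt

  _≟P_ : DecidableEquality Pt
  fin x ≟P fin y with x ≟ y
  ... | yes refl = yes refl
  ... | no x≢y = no (λ { refl → x≢y refl })
  fin x ≟P ∞ = no (λ ())
  ∞ ≟P fin y = no (λ ())
  ∞ ≟P ∞ = yes refl

  allPts : List Pt
  allPts = ∞ ∷ map (fin ∘ Inverse.to enum) (allFin q)

  möb : F → F → F → F → Pt → Pt
  möb a b c d (fin x) with (c * x + d) ≟ 0#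
  ... | yes _ = ∞
  ... | no _  = fin ((a * x + b) * ((c * x + d) ⁻¹))
  möb a b c d ∞ with c ≟ 0#
  ... | yes _ = ∞
  ... | no _  = fin (a * (c ⁻¹))

  IsPGL : (Pt → Pt) → Set
  IsPGL π = Σ F λ a → Σ F λ b → Σ F λ c → Σ F λ d →
              (a * d ≢ b * c) × (∀ x → π x ≡ möb a b c d x)

  rat : F → F → F → Pt → Pt
  rat a r i (fin x) with x ≟ i
  ... | yes _ = ∞
  ... | no _  = fin (a + r * ((x - i) ⁻¹))
  rat a r i ∞ = fin a

  hd : (Pt → Pt) → (Pt → Pt) → ℕ
  hd π σ = length (filter (λ x → ¬? (π x ≟P σ x)) allPts)

  tri : (Pt → Pt) → Pt → Pt
  tri π ∞ = ∞
  tri π (fin x) with π (fin x) ≟P ∞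
  ... | yes _ = π ∞
  ... | no _  = π (fin x)

  Adj : (Pt → Pt) → (Pt → Pt) → Set
  Adj π σ = ¬ (∀ x → π x ≡ σ x) × (hd (tri π) (tri σ) ≡ q ℕ.∸ 4)

  Isolated : (Pt → Pt) → Set
  Isolated π = ∀ σ → IsPGL σ → ¬ Adj π σ

-- Since π△ and σ△ both fix ∞, hd(π△, σ△) = q − (number of x ∈ GF(q) where they agree), so
-- adjacency means exactly four agreements.  Off the poles, agreement of a + r/(x − i) and
-- b + s/(x − j) is a quadratic equation in x, so four agreements force agreement at both poles i and
-- j, which says exactly r = s = (b − a)(j − i).  Conversely, under these conditions the two remaining
-- agreements are i + t(j − i) for the roots t of t² − t + 1, which exist because q ≡ 1 (mod 3).
-- A map fixing ∞ is affine and agrees with any other element of PGL(2,q) in at most three points,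
-- so it is isolated; any other π is of the form A + R/(x − I) and is adjacent to
-- A + R + R/(x − I − 1).
module Submission where

open import Algebra.Bundles using (CommutativeRing)
open import Algebra.Solver.Ring.AlmostCommutativeRing using (fromCommutativeRing; _-Raw-AlmostCommutative⟶_)
open import Data.Empty using (⊥; ⊥-elim)
open import Data.Integer as ℤ using (ℤ; +_; -[1+_]; _⊖_; _◃_; sign; ∣_∣)
import Data.Integer.Properties as ℤ
open import Data.List using (List; []; _∷_; length; filter; map; allFin)
open import Data.List.Membership.DecPropositional using () renaming (_∈?_ to ∈?)
open import Data.List.Membership.Propositional using (_∈_)
open import Data.List.Membership.Propositional.Properties using (∈-filter⁺; ∈-filter⁻; ∈-map⁺; ∈-allFin)
open import Data.List.Properties using (length-filter; filter-reject; filter-≐; length-map; length-tabulate)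
open import Data.List.Relation.Binary.Subset.Propositional using (_⊆_)
open import Data.List.Relation.Unary.All as All using ([]; _∷_)
open import Data.List.Relation.Unary.AllPairs using ([]; _∷_)
open import Data.List.Relation.Unary.Any as Any using (here; there; any?)
open import Data.List.Relation.Unary.Unique.Propositional using (Unique)
open import Data.List.Relation.Unary.Unique.Propositional.Properties using (filter⁺; map⁺; allFin⁺)
open import Data.Maybe using (Maybe; just; nothing)
open import Data.Nat as ℕ using (ℕ; zero; suc; _≤_; z≤n; s≤s; _∸_; _^_)
open import Data.Nat.DivMod using (_%_; [m+kn]%n≡m%n)
open import Data.Nat.Primality using (Prime)
import Data.Nat.Properties as ℕ
open import Data.Nat.Tactic.RingSolver using (solve-∀)
open import Data.Product using (Σ-syntax; ∃-syntax; _×_; _,_; proj₁; proj₂)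
open import Data.Sign as Sign using (Sign)
open import Data.Sum using (_⊎_; inj₁; inj₂)
open import Function using (_∘_; case_of_)
open import Function.Bundles using (Inverse; Equivalence; _⇔_; mk⇔)
open import Relation.Binary.Definitions using (DecidableEquality)
open import Relation.Binary.PropositionalEquality as ≡ using (_≡_; _≢_; refl; cong; cong₂; subst; module ≡-Reasoning)
open import Relation.Nullary using (¬_; yes; no; ¬?)
open import Relation.Nullary.Decidable using (decidable-stable)
open import Relation.Unary using (Pred; Decidable)
open import Relation.Unary.Properties using (∁?)

open import Defs

-- The ring solver with integer coefficients, acting through ℤ → R, so that numerals cancel by evaluation.
module IntegerCoefficients {c ℓ} (R : CommutativeRing c ℓ) where
  open CommutativeRing R renaming (refl to ≈-refl)
  open import Algebra.Properties.Semiring.Mult.TCOptimised semiring using (1+×; ×-homo-+; ×1-homo-*)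
    renaming (_×_ to _·_)
  open import Algebra.Properties.Ring ring using (-1*x≈-x; -‿involutive; -0#≈0#)
  open import Algebra.Properties.AbelianGroup +-abelianGroup using (⁻¹-∙-comm)
  open import Algebra.Properties.CommutativeSemigroup *-commutativeSemigroup using (x∙yz≈y∙xz)
  open import Relation.Binary.Reasoning.Setoid setoid

  private
    ⟦_⟧ : ℤ → Carrier
    ⟦ + n ⟧      = n · 1#
    ⟦ -[1+ n ] ⟧ = - (suc n · 1#)

    sg : Sign → Carrier
    sg Sign.+ = 1#
    sg Sign.- = - 1#

    sg-homo : ∀ s t → sg (s Sign.* t) ≈ sg s * sg t
    sg-homo Sign.+ t      = sym (*-identityˡ _)
    sg-homo Sign.- Sign.+ = sym (*-identityʳ _)
    sg-homo Sign.- Sign.- = sym (trans (-1*x≈-x (- 1#)) (-‿involutive 1#))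

    ◃-homo : ∀ s n → ⟦ s ◃ n ⟧ ≈ sg s * (n · 1#)
    ◃-homo s      zero    = sym (zeroʳ _)
    ◃-homo Sign.+ (suc n) = sym (*-identityˡ _)
    ◃-homo Sign.- (suc n) = sym (-1*x≈-x _)

    sign-abs : ∀ i → ⟦ i ⟧ ≈ sg (sign i) * (∣ i ∣ · 1#)
    sign-abs i = trans (reflexive (cong ⟦_⟧ (≡.sym (ℤ.◃-inverse i)))) (◃-homo (sign i) ∣ i ∣)

    shift-difference : ∀ x y z → x - y ≈ (z + x) - (z + y)
    shift-difference x y z = sym (begin
      (z + x) - (z + y)       ≈⟨ +-congˡ (sym (⁻¹-∙-comm z y)) ⟩
      (z + x) + (- z + - y)   ≈⟨ +-congʳ (+-comm z x) ⟩
      (x + z) + (- z + - y)   ≈⟨ +-assoc x z _ ⟩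
      x + (z + (- z + - y))   ≈⟨ +-congˡ (+-assoc z (- z) (- y)) ⟨
      x + ((z - z) + - y)     ≈⟨ +-congˡ (+-congʳ (-‿inverseʳ z)) ⟩
      x + (0# + - y)          ≈⟨ +-congˡ (+-identityˡ (- y)) ⟩
      x - y                   ∎)

    ⊖-homo : ∀ m n → ⟦ m ⊖ n ⟧ ≈ m · 1# - n · 1#
    ⊖-homo m       zero    = sym (trans (+-congˡ -0#≈0#) (+-identityʳ _))
    ⊖-homo zero    (suc n) = sym (+-identityˡ _)
    ⊖-homo (suc m) (suc n) = begin
      ⟦ suc m ⊖ suc n ⟧              ≡⟨ cong ⟦_⟧ (ℤ.[1+m]⊖[1+n]≡m⊖n m n) ⟩
      ⟦ m ⊖ n ⟧                      ≈⟨ ⊖-homo m n ⟩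
      m · 1# - n · 1#                ≈⟨ shift-difference _ _ 1# ⟩
      (1# + m · 1#) - (1# + n · 1#)  ≈⟨ +-cong (1+× m 1#) (-‿cong (1+× n 1#)) ⟨
      suc m · 1# - suc n · 1#        ∎

    +-homo : ∀ i j → ⟦ i ℤ.+ j ⟧ ≈ ⟦ i ⟧ + ⟦ j ⟧
    +-homo (+ m)    (+ n)    = ×-homo-+ 1# m n
    +-homo (+ m)    -[1+ n ] = ⊖-homo m (suc n)
    +-homo -[1+ m ] (+ n)    = trans (⊖-homo n (suc m)) (+-comm _ _)
    +-homo -[1+ m ] -[1+ n ] = begin
      - (suc (suc (m ℕ.+ n)) · 1#)     ≡⟨ cong (λ k → - (suc k · 1#)) (ℕ.+-suc m n) ⟨
      - ((suc m ℕ.+ suc n) · 1#)       ≈⟨ -‿cong (×-homo-+ 1# (suc m) (suc n)) ⟩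
      - (suc m · 1# + suc n · 1#)      ≈⟨ ⁻¹-∙-comm _ _ ⟨
      - (suc m · 1#) + - (suc n · 1#)  ∎

    *-homo : ∀ i j → ⟦ i ℤ.* j ⟧ ≈ ⟦ i ⟧ * ⟦ j ⟧
    *-homo i j = begin
      ⟦ i ℤ.* j ⟧                                           ≈⟨ ◃-homo (sign i Sign.* sign j) (∣ i ∣ ℕ.* ∣ j ∣) ⟩
      sg (sign i Sign.* sign j) * ((∣ i ∣ ℕ.* ∣ j ∣) · 1#)  ≈⟨ *-cong (sg-homo (sign i) (sign j)) (×1-homo-* ∣ i ∣ ∣ j ∣) ⟩
      (sg (sign i) * sg (sign j)) * (I * J)                 ≈⟨ *-assoc _ _ _ ⟩
      sg (sign i) * (sg (sign j) * (I * J))                 ≈⟨ *-congˡ (x∙yz≈y∙xz _ _ _) ⟩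
      sg (sign i) * (I * (sg (sign j) * J))                 ≈⟨ *-assoc _ _ _ ⟨
      (sg (sign i) * I) * (sg (sign j) * J)                 ≈⟨ *-cong (sign-abs i) (sign-abs j) ⟨
      ⟦ i ⟧ * ⟦ j ⟧                                         ∎
      where
      I = ∣ i ∣ · 1#
      J = ∣ j ∣ · 1#

    -‿homo : ∀ i → ⟦ ℤ.- i ⟧ ≈ - ⟦ i ⟧
    -‿homo (+ zero)  = sym -0#≈0#
    -‿homo (+ suc n) = ≈-refl
    -‿homo -[1+ n ]  = sym (-‿involutive _)

    morphism : ℤ.+-*-rawRing -Raw-AlmostCommutative⟶ fromCommutativeRing R
    morphism = record
      { ⟦_⟧ = ⟦_⟧ ; +-homo = +-homo ; *-homo = *-homo ; -‿homo = -‿homo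
      ; 0-homo = ≈-refl ; 1-homo = ≈-refl }

    ⟦⟧-equal? : ∀ i j → Maybe (⟦ i ⟧ ≈ ⟦ j ⟧)
    ⟦⟧-equal? i j with i ℤ.≟ j
    ... | yes refl = just ≈-refl
    ... | no _     = nothing

  open import Algebra.Solver.Ring ℤ.+-*-rawRing (fromCommutativeRing R) morphism ⟦⟧-equal? public
    using (solve; _:=_; _:+_; _:*_; _:-_; :-_; con)

length-filter-map : ∀ {a b p} {A : Set a} {B : Set b} {P : Pred B p} (P? : Decidable P) (f : A → B) xs →
                    length (filter P? (map f xs)) ≡ length (filter (P? ∘ f) xs)
length-filter-map P? f [] = refl
length-filter-map P? f (x ∷ xs) with P? (f x)
... | yes _ = cong suc (length-filter-map P? f xs)
... | no _  = length-filter-map P? f xs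

module UniqueCounting {a} {A : Set a} (_≟_ : DecidableEquality A) where

  private
    _without_ : List A → A → List A
    ys without x = filter (λ y → ¬? (y ≟ x)) ys

    length-without : ∀ {x ys} → x ∈ ys → suc (length (ys without x)) ≤ length ys
    length-without {x} {y ∷ ys} (here refl) with y ≟ y
    ... | yes _ = s≤s (length-filter (λ z → ¬? (z ≟ x)) ys)
    ... | no y≢y = ⊥-elim (y≢y refl)
    length-without {x} {y ∷ ys} (there x∈ys) with y ≟ x
    ... | yes _ = ℕ.m≤n⇒m≤1+n (length-without x∈ys)
    ... | no _  = s≤s (length-without x∈ys)

  Unique-⊆⇒length≤ : ∀ {xs ys} → Unique xs → xs ⊆ ys → length xs ≤ length ys
  Unique-⊆⇒length≤ {[]}     _            _  = z≤n
  Unique-⊆⇒length≤ {x ∷ xs} {ys} (x∉xs ∷ u) xs⊆ys =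
    ℕ.≤-trans (s≤s (Unique-⊆⇒length≤ u xs⊆ys-x)) (length-without (xs⊆ys (here refl)))
    where
    xs⊆ys-x : xs ⊆ ys without x
    xs⊆ys-x z∈xs = ∈-filter⁺ (λ y → ¬? (y ≟ x)) (xs⊆ys (there z∈xs)) (λ { refl → All.lookup x∉xs z∈xs refl })

  Unique⇒two-distinct : ∀ {l : List A} → Unique l → 2 ≤ length l → ∃[ y ] ∃[ z ] y ≢ z × y ∈ l × z ∈ l
  Unique⇒two-distinct {_ ∷ _ ∷ _} ((y≢z ∷ _) ∷ _) (s≤s (s≤s z≤n)) = _ , _ , y≢z , here refl , there (here refl)

  module _ {p} {P : Pred A p} (P? : Decidable P) where

    length-filter≤ : ∀ {l} L → Unique l → (∀ {x} → x ∈ l → P x → x ∈ L) → length (filter P? l) ≤ length L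
    length-filter≤ {l} L u h = Unique-⊆⇒length≤ (filter⁺ P? u) λ x∈ →
      let x∈l , px = ∈-filter⁻ P? {xs = l} x∈ in h x∈l px

    length-filter≥ : ∀ L {l} → Unique L → L ⊆ l → (∀ {x} → x ∈ L → P x) → length L ≤ length (filter P? l)
    length-filter≥ L u L⊆l h = Unique-⊆⇒length≤ u λ x∈L → ∈-filter⁺ P? (L⊆l x∈L) (h x∈L)

    length-filter+length-filter-∁ : ∀ l → length (filter P? l) ℕ.+ length (filter (∁? P?) l) ≡ length l
    length-filter+length-filter-∁ [] = refl
    length-filter+length-filter-∁ (x ∷ l) with P? x
    ... | yes _ = cong suc (length-filter+length-filter-∁ l)
    ... | no _  = ≡.trans (ℕ.+-suc _ _) (cong suc (length-filter+length-filter-∁ l))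

  module _ (ρ : A → A) where

    Fixed? : Decidable (λ x → ρ x ≡ x)
    Fixed? x = ρ x ≟ x

    private
      Invariant Periodic₃ : List A → Set a
      Invariant l = ∀ {x} → x ∈ l → ρ x ∈ l
      Periodic₃ l = ∀ {x} → x ∈ l → ρ (ρ (ρ x)) ≡ x

      3+[f+3k]≡f+3[1+k] : ∀ f k → 3 ℕ.+ (f ℕ.+ 3 ℕ.* k) ≡ f ℕ.+ 3 ℕ.* suc k
      3+[f+3k]≡f+3[1+k] = solve-∀

      module OrbitRemoval {x l} (x∈l : x ∈ l) (ρx≢x : ρ x ≢ x) (u : Unique l) (inv : Invariant l) (per : Periodic₃ l) where

        injective : ∀ {y z} → y ∈ l → z ∈ l → ρ y ≡ ρ z → y ≡ z
        injective y∈l z∈l ρy≡ρz = ≡.trans (≡.sym (per y∈l)) (≡.trans (cong (ρ ∘ ρ) ρy≡ρz) (per z∈l))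

        orbit : List A
        orbit = x ∷ ρ x ∷ ρ (ρ x) ∷ []

        ∈orbit? : Decidable (_∈ orbit)
        ∈orbit? y = ∈? _≟_ y orbit

        ρx∈l : ρ x ∈ l
        ρx∈l = inv x∈l

        x≢ρρx : x ≢ ρ (ρ x)
        x≢ρρx x≡ρρx = ρx≢x (≡.trans (cong ρ x≡ρρx) (per x∈l))

        orbit-unique : Unique orbit
        orbit-unique = ((ρx≢x ∘ ≡.sym) ∷ x≢ρρx ∷ []) ∷ ((ρx≢x ∘ ≡.sym ∘ injective x∈l ρx∈l) ∷ []) ∷ [] ∷ []

        orbit⊆l : orbit ⊆ l
        orbit⊆l (here refl)                 = x∈l
        orbit⊆l (there (here refl))         = ρx∈l
        orbit⊆l (there (there (here refl))) = inv ρx∈l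

        fixed∉orbit : ∀ {y} → ρ y ≡ y → ¬ y ∈ orbit
        fixed∉orbit ρx≡x     (here refl)                 = ρx≢x ρx≡x
        fixed∉orbit ρρx≡ρx   (there (here refl))         = ρx≢x (injective ρx∈l x∈l ρρx≡ρx)
        fixed∉orbit ρρρx≡ρρx (there (there (here refl))) = x≢ρρx (≡.trans (≡.sym (per x∈l)) ρρρx≡ρρx)

        l′ : List A
        l′ = filter (∁? ∈orbit?) l

        l′-unique : Unique l′
        l′-unique = filter⁺ (∁? ∈orbit?) u

        l′-invariant : Invariant l′
        l′-invariant y∈l′ = let y∈l , y∉orbit = ∈-filter⁻ (∁? ∈orbit?) {xs = l} y∈l′ in
          ∈-filter⁺ (∁? ∈orbit?) (inv y∈l) λ where
            (here ρy≡x)                   → y∉orbit (there (there (here (≡.trans (≡.sym (per y∈l)) (cong (ρ ∘ ρ) ρy≡x)))))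
            (there (here ρy≡ρx))          → y∉orbit (here (injective y∈l x∈l ρy≡ρx))
            (there (there (here ρy≡ρρx))) → y∉orbit (there (here (injective y∈l ρx∈l ρy≡ρρx)))

        l′-periodic : Periodic₃ l′
        l′-periodic y∈l′ = per (proj₁ (∈-filter⁻ (∁? ∈orbit?) {xs = l} y∈l′))

        3+length-l′ : 3 ℕ.+ length l′ ≡ length l
        3+length-l′ = ≡.trans (cong (ℕ._+ length l′) (≡.sym three)) (length-filter+length-filter-∁ ∈orbit? l)
          where
          three : length (filter ∈orbit? l) ≡ 3
          three = ℕ.≤-antisym (length-filter≤ ∈orbit? orbit u λ _ y∈orbit → y∈orbit)
                              (length-filter≥ ∈orbit? orbit orbit-unique orbit⊆l λ y∈orbit → y∈orbit)

        fixed-l′ : length (filter Fixed? l′) ≡ length (filter Fixed? l)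
        fixed-l′ = ℕ.≤-antisym (Unique-⊆⇒length≤ (filter⁺ Fixed? l′-unique) ⊆l)
                               (Unique-⊆⇒length≤ (filter⁺ Fixed? u) ⊆l′)
          where
          ⊆l : filter Fixed? l′ ⊆ filter Fixed? l
          ⊆l y∈ = let y∈l′ , ρy≡y = ∈-filter⁻ Fixed? {xs = l′} y∈ in
            ∈-filter⁺ Fixed? (proj₁ (∈-filter⁻ (∁? ∈orbit?) {xs = l} y∈l′)) ρy≡y
          ⊆l′ : filter Fixed? l ⊆ filter Fixed? l′
          ⊆l′ y∈ = let y∈l , ρy≡y = ∈-filter⁻ Fixed? {xs = l} y∈ in
            ∈-filter⁺ Fixed? (∈-filter⁺ (∁? ∈orbit?) y∈l (fixed∉orbit ρy≡y)) ρy≡y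

    -- Each orbit of ρ on l is a fixed point or has exactly three elements.
    length≡fixed+3k : ∀ l → Unique l → Invariant l → Periodic₃ l →
                      ∃[ k ] length l ≡ length (filter Fixed? l) ℕ.+ 3 ℕ.* k
    length≡fixed+3k l = go (length l) l ℕ.≤-refl
      where
      go : ∀ n l → length l ≤ n → Unique l → Invariant l → Periodic₃ l →
           ∃[ k ] length l ≡ length (filter Fixed? l) ℕ.+ 3 ℕ.* k
      go _       []       _         _          _   _   = 0 , refl
      go (suc n) (x ∷ xs) (s≤s len) (x∉xs ∷ u) inv per with Fixed? x
      ... | yes ρx≡x = let k , e = go n xs len u inv-xs (per ∘ there) in k , cong suc e
        where
        inv-xs : Invariant xs
        inv-xs {y} y∈xs with inv (there y∈xs)
        ... | there ρy∈xs = ρy∈xs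
        ... | here ρy≡x   = ⊥-elim (All.lookup x∉xs y∈xs (begin
          x            ≡⟨ ρx≡x ⟨
          ρ x          ≡⟨ cong ρ ρx≡x ⟨
          ρ (ρ x)      ≡⟨ cong (ρ ∘ ρ) ρy≡x ⟨
          ρ (ρ (ρ y))  ≡⟨ per (there y∈xs) ⟩
          y            ∎))
          where open ≡-Reasoning
      ... | no ρx≢x = suc k , (begin
          suc (length xs)                                 ≡⟨ 3+length-l′ ⟨
          3 ℕ.+ length l′                                 ≡⟨ cong (3 ℕ.+_) e ⟩
          3 ℕ.+ (length (filter Fixed? l′) ℕ.+ 3 ℕ.* k)   ≡⟨ 3+[f+3k]≡f+3[1+k] _ k ⟩
          length (filter Fixed? l′) ℕ.+ 3 ℕ.* suc k       ≡⟨ cong (ℕ._+ 3 ℕ.* suc k) fixed-l′ ⟩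
          length (filter Fixed? (x ∷ xs)) ℕ.+ 3 ℕ.* suc k ≡⟨ cong (λ l → length l ℕ.+ 3 ℕ.* suc k) (filter-reject Fixed? {xs = xs} ρx≢x) ⟩
          length (filter Fixed? xs) ℕ.+ 3 ℕ.* suc k       ∎)
        where
        open ≡-Reasoning
        open OrbitRemoval (here refl) ρx≢x (x∉xs ∷ u) inv per
        IH = go n l′ (ℕ.≤-pred (ℕ.≤-trans (ℕ.m≤n+m _ 2) (ℕ.≤-trans (ℕ.≤-reflexive 3+length-l′) (s≤s len))))
                l′-unique l′-invariant l′-periodic
        k = proj₁ IH
        e = proj₂ IH

private
  [2+f]+k*3≡2+[f+3k] : ∀ f k → (2 ℕ.+ f) ℕ.+ k ℕ.* 3 ≡ 2 ℕ.+ (f ℕ.+ 3 ℕ.* k)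
  [2+f]+k*3≡2+[f+3k] = solve-∀

[2+f+3k]%3≡1⇒2≤f : ∀ f k → (2 ℕ.+ (f ℕ.+ 3 ℕ.* k)) % 3 ≡ 1 → 2 ≤ f
[2+f+3k]%3≡1⇒2≤f f k h =
  2≤f f (≡.trans (≡.sym ([m+kn]%n≡m%n (2 ℕ.+ f) k 3)) (≡.trans (cong (_% 3) ([2+f]+k*3≡2+[f+3k] f k)) h))
  where
  2≤f : ∀ f → (2 ℕ.+ f) % 3 ≡ 1 → 2 ≤ f
  2≤f (suc (suc _)) _ = s≤s (s≤s z≤n)

module FiniteFieldProperties {q} (K : FiniteField q) where
  open FiniteField K

  commutativeRing : CommutativeRing _ _
  commutativeRing = record { isCommutativeRing = isCommutativeRing }

  open CommutativeRing commutativeRing using (+-group; *-comm; *-identityˡ; *-identityʳ; zeroˡ; zeroʳ)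
  open import Algebra.Properties.Group +-group public using (x∙y⁻¹≈ε⇒x≈y; x≈y⇒x∙y⁻¹≈ε)
  open IntegerCoefficients commutativeRing public
  open UniqueCounting _≟_ public

  ⁻¹-inverseˡ : ∀ {x} → x ≢ 0# → x ⁻¹ * x ≡ 1#
  ⁻¹-inverseˡ {x} x≢0 = ≡.trans (*-comm _ _) (inverseʳ x x≢0)

  1-x⁻¹*x≡0 : ∀ {x} → x ≢ 0# → 1# - x ⁻¹ * x ≡ 0#
  1-x⁻¹*x≡0 x≢0 = x≈y⇒x∙y⁻¹≈ε (≡.sym (⁻¹-inverseˡ x≢0))

  x≢y⇒x-y≢0 : ∀ {x y} → x ≢ y → x - y ≢ 0#
  x≢y⇒x-y≢0 x≢y x-y≡0 = x≢y (x∙y⁻¹≈ε⇒x≈y _ _ x-y≡0)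

  ⁻¹-unique : ∀ {x y} → x * y ≡ 1# → y ≡ x ⁻¹
  ⁻¹-unique {x} {y} xy≡1 with x ≟ 0#
  ... | yes refl = ⊥-elim (0≢1 (≡.trans (≡.sym (zeroˡ y)) xy≡1))
  ... | no x≢0 = begin
    y                ≡⟨ *-identityʳ y ⟨
    y * 1#           ≡⟨ cong (y *_) (inverseʳ x x≢0) ⟨
    y * (x * x ⁻¹)   ≡⟨ solve 3 (λ x y w → y :* (x :* w) := (x :* y) :* w) ≡.refl x y (x ⁻¹) ⟩
    (x * y) * x ⁻¹   ≡⟨ cong (_* x ⁻¹) xy≡1 ⟩
    1# * x ⁻¹        ≡⟨ *-identityˡ _ ⟩
    x ⁻¹             ∎
    where open ≡-Reasoning

  ⁻¹-≢0 : ∀ {x} → x ≢ 0# → x ⁻¹ ≢ 0#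
  ⁻¹-≢0 {x} x≢0 x⁻¹≡0 = 0≢1 (≡.trans (≡.sym (zeroʳ x)) (≡.trans (cong (x *_) (≡.sym x⁻¹≡0)) (inverseʳ x x≢0)))

  -- A consequence G ≡ 0# of hypotheses eᵢ ≡ 0# is certified by a ring identity G ≡ Σ cᵢ * eᵢ.
  vanishes₁ : ∀ {G c e} → e ≡ 0# → G ≡ c * e → G ≡ 0#
  vanishes₁ {c = c} e≡0 G≡ce = ≡.trans G≡ce (≡.trans (cong (c *_) e≡0) (zeroʳ c))

  vanishes₂ : ∀ {G c₁ e₁ c₂ e₂} → e₁ ≡ 0# → e₂ ≡ 0# → G ≡ c₁ * e₁ + c₂ * e₂ → G ≡ 0#
  vanishes₂ {c₁ = c₁} {c₂ = c₂} e₁≡0 e₂≡0 G≡ = ≡.trans G≡ (≡.trans (cong₂ (λ u v → c₁ * u + c₂ * v) e₁≡0 e₂≡0)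
    (solve 2 (λ c₁ c₂ → c₁ :* con (+ 0) :+ c₂ :* con (+ 0) := con (+ 0)) ≡.refl c₁ c₂))

  vanishes₃ : ∀ {G c₁ e₁ c₂ e₂ c₃ e₃} → e₁ ≡ 0# → e₂ ≡ 0# → e₃ ≡ 0# → G ≡ c₁ * e₁ + c₂ * e₂ + c₃ * e₃ → G ≡ 0#
  vanishes₃ {c₁ = c₁} {e₁} {c₂} {e₂} e₁≡0 e₂≡0 e₃≡0 G≡ =
    vanishes₂ {c₁ = 1#} (vanishes₂ {c₁ * e₁ + c₂ * e₂} e₁≡0 e₂≡0 ≡.refl) e₃≡0 (≡.trans G≡ (cong (_+ _) (≡.sym (*-identityˡ _))))

  x*y≡0⇒x≡0⊎y≡0 : ∀ {x y} → x * y ≡ 0# → x ≡ 0# ⊎ y ≡ 0#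
  x*y≡0⇒x≡0⊎y≡0 {x} {y} xy≡0 with x ≟ 0#
  ... | yes x≡0 = inj₁ x≡0
  ... | no x≢0  = inj₂ (vanishes₂ xy≡0 (1-x⁻¹*x≡0 x≢0)
    (solve 3 (λ x y w → y := w :* (x :* y) :+ y :* (con (+ 1) :- w :* x)) ≡.refl x y (x ⁻¹)))

  x≢0∧y≢0⇒x*y≢0 : ∀ {x y} → x ≢ 0# → y ≢ 0# → x * y ≢ 0#
  x≢0∧y≢0⇒x*y≢0 x≢0 y≢0 xy≡0 with x*y≡0⇒x≡0⊎y≡0 xy≡0
  ... | inj₁ x≡0 = x≢0 x≡0
  ... | inj₂ y≡0 = y≢0 y≡0

  linear-root : ∀ {a b x} → a ≢ 0# → a * x + b ≡ 0# → x ≡ - (b * a ⁻¹)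
  linear-root {a} {b} {x} a≢0 ax+b≡0 = x∙y⁻¹≈ε⇒x≈y _ _ (vanishes₂ ax+b≡0 (1-x⁻¹*x≡0 a≢0)
    (solve 4 (λ a b x w → x :- :- (b :* w) := w :* (a :* x :+ b) :+ x :* (con (+ 1) :- w :* a)) ≡.refl a b x (a ⁻¹)))

  elements : List F
  elements = map (Inverse.to enum) (allFin q)

  ∈-elements : ∀ x → x ∈ elements
  ∈-elements x = subst (_∈ elements) (Inverse.strictlyInverseˡ enum x)
                       (∈-map⁺ (Inverse.to enum) (∈-allFin (Inverse.from enum x)))

  elements-unique : Unique elements
  elements-unique = map⁺ to-injective (allFin⁺ q)
    where
    to-injective : ∀ {i j} → Inverse.to enum i ≡ Inverse.to enum j → i ≡ j
    to-injective {i} {j} e = ≡.trans (≡.sym (Inverse.strictlyInverseʳ enum i))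
                                     (≡.trans (cong (Inverse.from enum) e) (Inverse.strictlyInverseʳ enum j))

  length-elements : length elements ≡ q
  length-elements = ≡.trans (length-map _ (allFin q)) (length-tabulate (λ i → i))

  quadratic-roots : ∀ {a} b c → a ≢ 0# → Σ[ L ∈ List F ] length L ≤ 2 × (∀ {x} → a * x * x + b * x + c ≡ 0# → x ∈ L)
  quadratic-roots {a} b c a≢0 with any? (λ x → (a * x * x + b * x + c) ≟ 0#) elements
  ... | no no-root = [] , z≤n , λ {x} root → ⊥-elim (no-root (Any.map (λ { refl → root }) (∈-elements x)))
  ... | yes some-root with Any.satisfied some-root
  ...   | x₀ , root₀ = x₀ ∷ x₁ ∷ [] , s≤s (s≤s z≤n) , roots⊆
    where
    x₁ = - ((a * x₀ + b) * a ⁻¹)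
    -- Vieta: the roots of a x² + b x + c are x₀ and the root of a x + (a x₀ + b).
    roots⊆ : ∀ {x} → a * x * x + b * x + c ≡ 0# → x ∈ x₀ ∷ x₁ ∷ []
    roots⊆ {x} root with x*y≡0⇒x≡0⊎y≡0 (vanishes₂ root root₀
      (solve 5 (λ a b c x x₀ → (x :- x₀) :* (a :* x :+ (a :* x₀ :+ b))
         := con (+ 1) :* (a :* x :* x :+ b :* x :+ c) :+ con (-[1+ 0 ]) :* (a :* x₀ :* x₀ :+ b :* x₀ :+ c)) ≡.refl a b c x x₀))
    ... | inj₁ x-x₀≡0 = here (x∙y⁻¹≈ε⇒x≈y _ _ x-x₀≡0)
    ... | inj₂ linear = there (here (linear-root a≢0 linear))

  a+r*d⁻¹≡b⇔[b-a]*d≡r : ∀ {a b r d} → d ≢ 0# → (a + r * d ⁻¹ ≡ b) ⇔ ((b - a) * d ≡ r)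
  a+r*d⁻¹≡b⇔[b-a]*d≡r {a} {b} {r} {d} d≢0 = mk⇔
    (λ eq → x∙y⁻¹≈ε⇒x≈y _ _ (vanishes₂ (x≈y⇒x∙y⁻¹≈ε eq) (1-x⁻¹*x≡0 d≢0)
      (solve 5 (λ a b r d w → (b :- a) :* d :- r := (:- d) :* ((a :+ r :* w) :- b) :+ (:- r) :* (con (+ 1) :- w :* d)) ≡.refl a b r d (d ⁻¹))))
    (λ eq → x∙y⁻¹≈ε⇒x≈y _ _ (vanishes₂ (x≈y⇒x∙y⁻¹≈ε eq) (1-x⁻¹*x≡0 d≢0)
      (solve 5 (λ a b r d w → (a :+ r :* w) :- b := (:- w) :* ((b :- a) :* d :- r) :+ (:- (b :- a)) :* (con (+ 1) :- w :* d)) ≡.refl a b r d (d ⁻¹))))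

  x²-x+1≡0⇒x≢0 : ∀ {x} → x * x - x + 1# ≡ 0# → x ≢ 0#
  x²-x+1≡0⇒x≢0 root refl = 0≢1 (≡.trans (≡.sym root) (solve 0 (con (+ 0) :* con (+ 0) :- con (+ 0) :+ con (+ 1) := con (+ 1)) ≡.refl))

  x²-x+1≡0⇒x≢1 : ∀ {x} → x * x - x + 1# ≡ 0# → x ≢ 1#
  x²-x+1≡0⇒x≢1 root refl = 0≢1 (≡.trans (≡.sym root) (solve 0 (con (+ 1) :* con (+ 1) :- con (+ 1) :+ con (+ 1) := con (+ 1)) ≡.refl))

  private
    module PeriodThree where
      τ : F → F
      τ x = (1# - x) ⁻¹

      zero-one : List F
      zero-one = 0# ∷ 1# ∷ []

      S : List F
      S = filter (λ x → ¬? (∈? _≟_ x zero-one)) elements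

      S-unique : Unique S
      S-unique = filter⁺ _ elements-unique

      ∈S⇒ : ∀ {x} → x ∈ S → x ≢ 0# × x ≢ 1#
      ∈S⇒ x∈S = let _ , x∉zero-one = ∈-filter⁻ (λ x → ¬? (∈? _≟_ x zero-one)) {xs = elements} x∈S
                in (λ x≡0 → x∉zero-one (here x≡0)) , (λ x≡1 → x∉zero-one (there (here x≡1)))

      ⇒∈S : ∀ {x} → x ≢ 0# → x ≢ 1# → x ∈ S
      ⇒∈S {x} x≢0 x≢1 = ∈-filter⁺ (λ x → ¬? (∈? _≟_ x zero-one)) (∈-elements x) λ where
        (here x≡0) → x≢0 x≡0
        (there (here x≡1)) → x≢1 x≡1

      τ-inverse : ∀ {x} → x ≢ 1# → (1# - x) * τ x - 1# ≡ 0#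
      τ-inverse x≢1 = x≈y⇒x∙y⁻¹≈ε (inverseʳ _ (x≢y⇒x-y≢0 (x≢1 ∘ ≡.sym)))

      τ-stays : ∀ {x} → x ≢ 0# → x ≢ 1# → τ x ≢ 0# × τ x ≢ 1#
      τ-stays {x} x≢0 x≢1 = ⁻¹-≢0 (x≢y⇒x-y≢0 (x≢1 ∘ ≡.sym)) , λ τx≡1 → x≢0 (vanishes₂ (τ-inverse x≢1) (x≈y⇒x∙y⁻¹≈ε τx≡1)
        (solve 2 (λ x u → x := con (-[1+ 0 ]) :* ((con (+ 1) :- x) :* u :- con (+ 1)) :+ (con (+ 1) :- x) :* (u :- con (+ 1)))
          ≡.refl x (τ x)))

      τ³ : ∀ {x} → x ≢ 0# → x ≢ 1# → τ (τ (τ x)) ≡ x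
      τ³ {x} x≢0 x≢1 = ≡.sym (⁻¹-unique (x∙y⁻¹≈ε⇒x≈y _ _
        (vanishes₂ (τ-inverse x≢1) (τ-inverse (proj₂ (τ-stays x≢0 x≢1)))
          (solve 3 (λ x u v → (con (+ 1) :- v) :* x :- con (+ 1)
             := v :* ((con (+ 1) :- x) :* u :- con (+ 1)) :+ (con (+ 1) :- x) :* ((con (+ 1) :- u) :* v :- con (+ 1)))
            ≡.refl x (τ x) (τ (τ x))))))

      fixed-root : ∀ {x} → x ∈ filter (Fixed? τ) S → x * x - x + 1# ≡ 0#
      fixed-root {x} x∈ = let x∈S , τx≡x = ∈-filter⁻ (Fixed? τ) {xs = S} x∈ in
        vanishes₁ (subst (λ u → (1# - x) * u - 1# ≡ 0#) τx≡x (τ-inverse (proj₂ (∈S⇒ x∈S))))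
          (solve 1 (λ x → x :* x :- x :+ con (+ 1) := con (-[1+ 0 ]) :* ((con (+ 1) :- x) :* x :- con (+ 1))) ≡.refl x)

      length-S : 2 ℕ.+ length S ≡ q
      length-S = ≡.trans (cong (ℕ._+ length S) (≡.sym two))
                         (≡.trans (length-filter+length-filter-∁ (λ x → ∈? _≟_ x zero-one) elements) length-elements)
        where
        two : length (filter (λ x → ∈? _≟_ x zero-one) elements) ≡ 2
        two = ℕ.≤-antisym
          (length-filter≤ (λ x → ∈? _≟_ x zero-one) zero-one elements-unique λ _ x∈ → x∈)
          (length-filter≥ (λ x → ∈? _≟_ x zero-one) zero-one ((0≢1 ∷ []) ∷ [] ∷ []) (λ _ → ∈-elements _) λ x∈ → x∈)

  open PeriodThree

  -- x ↦ (1 - x)⁻¹ permutes F ∖ {0, 1} with period 3 and its fixed points are the roots of x² - x + 1,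
  -- so their number is ≡ q - 2 ≡ 2 (mod 3).
  x²-x+1-two-roots : q % 3 ≡ 1 → ∃[ y ] ∃[ z ] y ≢ z × y * y - y + 1# ≡ 0# × z * z - z + 1# ≡ 0#
  x²-x+1-two-roots q%3≡1 =
    let y , z , y≢z , y∈ , z∈ = Unique⇒two-distinct (filter⁺ (Fixed? τ) S-unique) ([2+f+3k]%3≡1⇒2≤f _ k [2+f+3k]%3≡1)
    in y , z , y≢z , fixed-root y∈ , fixed-root z∈
    where
    orbits = length≡fixed+3k τ S S-unique
      (λ x∈S → let x≢0 , x≢1 = ∈S⇒ x∈S ; τx≢0 , τx≢1 = τ-stays x≢0 x≢1 in ⇒∈S τx≢0 τx≢1)
      (λ x∈S → let x≢0 , x≢1 = ∈S⇒ x∈S in τ³ x≢0 x≢1)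
    k = proj₁ orbits

    [2+f+3k]%3≡1 : (2 ℕ.+ (length (filter (Fixed? τ) S) ℕ.+ 3 ℕ.* k)) % 3 ≡ 1
    [2+f+3k]%3≡1 = ≡.trans (cong (λ n → (2 ℕ.+ n) % 3) (≡.sym (proj₂ orbits))) (≡.trans (cong (_% 3) length-S) q%3≡1)

module Contraction {q} (K : FiniteField q) where
  open FiniteField K
  open PGL K
  open FiniteFieldProperties K
  open CommutativeRing commutativeRing using (*-identityˡ; *-identityʳ; zeroˡ; zeroʳ; -‿inverseʳ)

  fin≢∞ : ∀ {x} → fin x ≢ ∞
  fin≢∞ ()

  tri-finite : ∀ π {x} → π (fin x) ≢ ∞ → tri π (fin x) ≡ π (fin x)
  tri-finite π {x} πx≢∞ with π (fin x) ≟P ∞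
  ... | yes πx≡∞ = ⊥-elim (πx≢∞ πx≡∞)
  ... | no _     = refl

  tri-pole : ∀ π {x} → π (fin x) ≡ ∞ → tri π (fin x) ≡ π ∞
  tri-pole π {x} πx≡∞ with π (fin x) ≟P ∞
  ... | yes _     = refl
  ... | no πx≢∞ = ⊥-elim (πx≢∞ πx≡∞)

  tri-cong : ∀ {π π′} → (∀ p → π p ≡ π′ p) → ∀ p → tri π p ≡ tri π′ p
  tri-cong π≗π′ ∞ = refl
  tri-cong {π} {π′} π≗π′ (fin x) with π′ (fin x) ≟P ∞
  ... | yes π′x≡∞ = ≡.trans (tri-pole π (≡.trans (π≗π′ _) π′x≡∞)) (π≗π′ ∞)
  ... | no π′x≢∞  = ≡.trans (tri-finite π (π′x≢∞ ∘ ≡.trans (≡.sym (π≗π′ _)))) (π≗π′ _)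

  Adj-respˡ : ∀ {π π′ σ} → (∀ p → π p ≡ π′ p) → Adj π′ σ → Adj π σ
  Adj-respˡ {π} {π′} {σ} π≗π′ (π′≢σ , hd≡) = (λ π≗σ → π′≢σ λ p → ≡.trans (≡.sym (π≗π′ p)) (π≗σ p)) ,
    ≡.trans (cong length (filter-≐ (differ? π) (differ? π′) same-differences allPts)) hd≡
    where
    differ? = λ ρ p → ¬? (tri ρ p ≟P tri σ p)
    same-differences = (λ {p} ≢σ ≡σ → ≢σ (≡.trans (tri-cong π≗π′ p) ≡σ))
                     , (λ {p} ≢σ ≡σ → ≢σ (≡.trans (≡.sym (tri-cong π≗π′ p)) ≡σ))

  rat-pole : ∀ {a r i} → rat a r i (fin i) ≡ ∞
  rat-pole {i = i} with i ≟ i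
  ... | yes _  = refl
  ... | no i≢i = ⊥-elim (i≢i refl)

  rat-regular : ∀ {a r i x} → x ≢ i → rat a r i (fin x) ≡ fin (a + r * (x - i) ⁻¹)
  rat-regular {i = i} {x} x≢i with x ≟ i
  ... | yes x≡i = ⊥-elim (x≢i x≡i)
  ... | no _    = refl

  -- rat△ a r i is the finite part of (rat a r i)△: the pole i is sent to rat a r i ∞ = a.
  rat△ : F → F → F → F → F
  rat△ a r i x with x ≟ i
  ... | yes _ = a
  ... | no _  = a + r * (x - i) ⁻¹

  rat△-pole : ∀ {a r i} → rat△ a r i i ≡ a
  rat△-pole {i = i} with i ≟ i
  ... | yes _  = refl
  ... | no i≢i = ⊥-elim (i≢i refl)

  rat△-regular : ∀ {a r i x} → x ≢ i → rat△ a r i x ≡ a + r * (x - i) ⁻¹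
  rat△-regular {i = i} {x} x≢i with x ≟ i
  ... | yes x≡i = ⊥-elim (x≢i x≡i)
  ... | no _    = refl

  tri-rat : ∀ a r i x → tri (rat a r i) (fin x) ≡ fin (rat△ a r i x)
  tri-rat a r i x = case x ≟ i of λ where
    (yes refl) → ≡.trans (tri-pole (rat a r i) (rat-pole {a} {r})) (cong fin (≡.sym (rat△-pole {a} {r})))
    (no x≢i)   → ≡.trans (tri-finite (rat a r i) (fin≢∞ ∘ ≡.trans (≡.sym (rat-regular x≢i))))
                         (≡.trans (rat-regular x≢i) (cong fin (≡.sym (rat△-regular {a} {r} x≢i))))

  TriValues : (Pt → Pt) → (F → F) → Set
  TriValues π V = ∀ x → tri π (fin x) ≡ fin (V x)

  agreements : (F → F) → (F → F) → ℕ
  agreements V W = length (filter (λ x → V x ≟ W x) elements)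

  hd+agreements≡q : ∀ {π σ V W} → TriValues π V → TriValues σ W → hd (tri π) (tri σ) ℕ.+ agreements V W ≡ q
  hd+agreements≡q {π} {σ} {V} {W} πV σW = begin
    hd (tri π) (tri σ) ℕ.+ A
      ≡⟨ cong (ℕ._+ A) (length-filter-map differ? (fin ∘ to) (allFin q)) ⟩
    length (filter (differ? ∘ fin ∘ to) (allFin q)) ℕ.+ A
      ≡⟨ cong (λ l → length l ℕ.+ A) (filter-≐ (differ? ∘ fin ∘ to) (∁? agree? ∘ to) same (allFin q)) ⟩
    length (filter (∁? agree? ∘ to) (allFin q)) ℕ.+ A
      ≡⟨ cong (ℕ._+ A) (length-filter-map (∁? agree?) to (allFin q)) ⟨
    length (filter (∁? agree?) elements) ℕ.+ A
      ≡⟨ ℕ.+-comm _ A ⟩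
    A ℕ.+ length (filter (∁? agree?) elements)
      ≡⟨ length-filter+length-filter-∁ agree? elements ⟩
    length elements
      ≡⟨ length-elements ⟩
    q ∎
    where
    open ≡-Reasoning
    to = Inverse.to enum
    A = agreements V W
    differ? = λ p → ¬? (tri π p ≟P tri σ p)
    agree? = λ x → V x ≟ W x
    same = (λ {y} πy≢σy Vy≡Wy → πy≢σy (≡.trans (πV (to y)) (≡.trans (cong fin Vy≡Wy) (≡.sym (σW (to y))))))
         , (λ {y} Vy≢Wy πy≡σy → Vy≢Wy (fin-injective (≡.trans (≡.sym (πV (to y))) (≡.trans πy≡σy (σW (to y))))))
      where
      fin-injective : ∀ {x y} → fin x ≡ fin y → x ≡ y
      fin-injective refl = refl

  Adj⇒agreements≡4 : ∀ {π σ V W} → 4 ≤ q → TriValues π V → TriValues σ W → Adj π σ → agreements V W ≡ 4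
  Adj⇒agreements≡4 {π} {σ} {V} {W} 4≤q πV σW (_ , hd≡q∸4) = ℕ.+-cancelˡ-≡ (q ∸ 4) _ _ (begin
    (q ∸ 4) ℕ.+ agreements V W           ≡⟨ cong (ℕ._+ agreements V W) hd≡q∸4 ⟨
    hd (tri π) (tri σ) ℕ.+ agreements V W ≡⟨ hd+agreements≡q πV σW ⟩
    q                                     ≡⟨ ℕ.m∸n+n≡m 4≤q ⟨
    (q ∸ 4) ℕ.+ 4                         ∎)
    where open ≡-Reasoning

  agreements≡4⇒Adj : ∀ {π σ V W} → TriValues π V → TriValues σ W → ¬ (∀ p → π p ≡ σ p) → agreements V W ≡ 4 → Adj π σ
  agreements≡4⇒Adj {π} {σ} {V} {W} πV σW π≢σ four = π≢σ , (begin
    hd (tri π) (tri σ)                         ≡⟨ ℕ.m+n∸n≡m _ 4 ⟨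
    hd (tri π) (tri σ) ℕ.+ 4 ∸ 4               ≡⟨ cong (λ n → hd (tri π) (tri σ) ℕ.+ n ∸ 4) four ⟨
    hd (tri π) (tri σ) ℕ.+ agreements V W ∸ 4  ≡⟨ cong (_∸ 4) (hd+agreements≡q πV σW) ⟩
    q ∸ 4                                      ∎)
    where open ≡-Reasoning

  agreements≤ : ∀ {V W} L → (∀ {x} → V x ≡ W x → x ∈ L) → agreements V W ≤ length L
  agreements≤ {V} {W} L agree⇒∈L = length-filter≤ (λ x → V x ≟ W x) L elements-unique λ _ → agree⇒∈L

  agreements≥ : ∀ {V W} L → Unique L → (∀ {x} → x ∈ L → V x ≡ W x) → length L ≤ agreements V W
  agreements≥ {V} {W} L unique ∈L⇒agree = length-filter≥ (λ x → V x ≟ W x) L unique (λ {x} _ → ∈-elements x) ∈L⇒agree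

  few-agreements⇒¬Adj : ∀ {π σ V W} → 4 ≤ q → TriValues π V → TriValues σ W →
                        ∀ L → length L ≤ 3 → (∀ {x} → V x ≡ W x → x ∈ L) → ¬ Adj π σ
  few-agreements⇒¬Adj 4≤q πV σW L length≤3 agree⇒∈L adj =
    ℕ.<⇒≢ (s≤s (ℕ.≤-trans (agreements≤ L agree⇒∈L) length≤3)) (Adj⇒agreements≡4 4≤q πV σW adj)

  rat△-agree⇒quadratic : ∀ {a b r s i j x} → x ≢ i → x ≢ j → rat△ a r i x ≡ rat△ b s j x →
    (a - b) * x * x + (r - s - (a - b) * (i + j)) * x + ((a - b) * i * j - r * j + s * i) ≡ 0#
  rat△-agree⇒quadratic {a} {b} {r} {s} {i} {j} {x} x≢i x≢j agree = vanishes₃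
    (x≈y⇒x∙y⁻¹≈ε (≡.trans (≡.sym (rat△-regular x≢i)) (≡.trans agree (rat△-regular x≢j))))
    (1-x⁻¹*x≡0 (x≢y⇒x-y≢0 x≢i))
    (1-x⁻¹*x≡0 (x≢y⇒x-y≢0 x≢j))
    (solve 9 (λ a b r s i j x u v →
       (a :- b) :* x :* x :+ (r :- s :- (a :- b) :* (i :+ j)) :* x :+ ((a :- b) :* i :* j :- r :* j :+ s :* i)
       := ((x :- i) :* (x :- j)) :* ((a :+ r :* u) :- (b :+ s :* v)) :+ (r :* (x :- j)) :* (con (+ 1) :- u :* (x :- i))
          :+ (:- (s :* (x :- i))) :* (con (+ 1) :- v :* (x :- j))) ≡.refl a b r s i j x ((x - i) ⁻¹) ((x - j) ⁻¹))

  off-pole-agreements : ∀ {a b r s i j} → r ≢ 0# → ¬ (a ≡ b × r ≡ s × i ≡ j) →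
    Σ[ L ∈ List F ] length L ≤ 2 × (∀ {x} → x ≢ i → x ≢ j → rat△ a r i x ≡ rat△ b s j x → x ∈ L)
  off-pole-agreements {a} {b} {r} {s} {i} {j} r≢0 distinct with a ≟ b
  ... | no a≢b = let L , |L|≤2 , roots⊆L = quadratic-roots _ _ (x≢y⇒x-y≢0 a≢b) in
    L , |L|≤2 , λ x≢i x≢j agree → roots⊆L (rat△-agree⇒quadratic x≢i x≢j agree)
  ... | yes refl with r ≟ s
  ...   | no r≢s = - ((s * i - r * j) * (r - s) ⁻¹) ∷ [] , s≤s z≤n , λ {x} x≢i x≢j agree →
    here (linear-root (x≢y⇒x-y≢0 r≢s) (≡.trans
      (solve 6 (λ a r s i j x → (r :- s) :* x :+ (s :* i :- r :* j)
         := (a :- a) :* x :* x :+ (r :- s :- (a :- a) :* (i :+ j)) :* x :+ ((a :- a) :* i :* j :- r :* j :+ s :* i)) ≡.refl a r s i j x)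
      (rat△-agree⇒quadratic x≢i x≢j agree)))
  ...   | yes refl = [] , z≤n , λ {x} x≢i x≢j agree →
    case x*y≡0⇒x≡0⊎y≡0 (≡.trans
      (solve 5 (λ a r i j x → r :* (i :- j)
         := (a :- a) :* x :* x :+ (r :- r :- (a :- a) :* (i :+ j)) :* x :+ ((a :- a) :* i :* j :- r :* j :+ r :* i)) ≡.refl a r i j x)
      (rat△-agree⇒quadratic x≢i x≢j agree)) of λ where
      (inj₁ r≡0)   → ⊥-elim (r≢0 r≡0)
      (inj₂ i-j≡0) → ⊥-elim (distinct (refl , refl , x∙y⁻¹≈ε⇒x≈y _ _ i-j≡0))

  rat△-agrees-at-pole⇔ : ∀ {a b r s i j} → i ≢ j → (rat△ a r i j ≡ rat△ b s j j) ⇔ ((b - a) * (j - i) ≡ r)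
  rat△-agrees-at-pole⇔ {a} {b} {r} {s} {i} {j} i≢j = mk⇔
    (λ agree → Equivalence.to equation (≡.trans (≡.sym (rat△-regular (i≢j ∘ ≡.sym))) (≡.trans agree (rat△-pole {b} {s}))))
    (λ eq → ≡.trans (rat△-regular (i≢j ∘ ≡.sym)) (≡.trans (Equivalence.from equation eq) (≡.sym (rat△-pole {b} {s}))))
    where equation = a+r*d⁻¹≡b⇔[b-a]*d≡r (x≢y⇒x-y≢0 (i≢j ∘ ≡.sym))

  rat-Adj⇒ : ∀ {a b r s i j} → 4 ≤ q → r ≢ 0# → Adj (rat a r i) (rat b s j) → r ≡ s × (b - a) * (j - i) ≡ r
  rat-Adj⇒ {a} {b} {r} {s} {i} {j} 4≤q r≢0 adj = r≡s , [b-a][j-i]≡r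
    where
    open ≡-Reasoning
    V = rat△ a r i
    W = rat△ b s j
    distinct : ¬ (a ≡ b × r ≡ s × i ≡ j)
    distinct (refl , refl , refl) = proj₁ adj λ _ → refl
    off-poles = off-pole-agreements r≢0 distinct
    L = proj₁ off-poles
    both-poles : ∀ p → (∀ {x} → V x ≡ W x → x ≢ p → x ≢ i × x ≢ j) → ⊥
    both-poles p avoid =
      few-agreements⇒¬Adj 4≤q (tri-rat a r i) (tri-rat b s j) (p ∷ L) (s≤s (proj₁ (proj₂ off-poles))) ∈p∷L adj
      where
      ∈p∷L : ∀ {x} → V x ≡ W x → x ∈ p ∷ L
      ∈p∷L {x} agree = case x ≟ p of λ where
        (yes x≡p) → here x≡p
        (no x≢p)  → let x≢i , x≢j = avoid agree x≢p in there (proj₂ (proj₂ off-poles) x≢i x≢j agree)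
    i≢j : i ≢ j
    i≢j refl = both-poles i λ _ x≢i → x≢i , x≢i
    agree-i : V i ≡ W i
    agree-i = decidable-stable (V i ≟ W i) λ disagree → both-poles j λ where
      agree x≢j → (λ { refl → disagree agree }) , x≢j
    agree-j : V j ≡ W j
    agree-j = decidable-stable (V j ≟ W j) λ disagree → both-poles i λ where
      agree x≢i → x≢i , λ { refl → disagree agree }
    [b-a][j-i]≡r : (b - a) * (j - i) ≡ r
    [b-a][j-i]≡r = Equivalence.to (rat△-agrees-at-pole⇔ i≢j) agree-j
    r≡s : r ≡ s
    r≡s = begin
      r                  ≡⟨ [b-a][j-i]≡r ⟨
      (b - a) * (j - i)  ≡⟨ solve 4 (λ a b i j → (b :- a) :* (j :- i) := (a :- b) :* (i :- j)) ≡.refl a b i j ⟩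
      (a - b) * (i - j)  ≡⟨ Equivalence.to (rat△-agrees-at-pole⇔ {b} {a} {s} {r} (i≢j ∘ ≡.sym)) (≡.sym agree-i) ⟩
      s                  ∎

  rat△-agreements≤4 : ∀ {a b r s i j} → r ≢ 0# → i ≢ j → agreements (rat△ a r i) (rat△ b s j) ≤ 4
  rat△-agreements≤4 {a} {b} {r} {s} {i} {j} r≢0 i≢j =
    ℕ.≤-trans (agreements≤ (i ∷ j ∷ proj₁ off-poles) ∈i∷j∷L) (s≤s (s≤s (proj₁ (proj₂ off-poles))))
    where
    off-poles = off-pole-agreements {a} {b} {r} {s} r≢0 λ (_ , _ , i≡j) → i≢j i≡j
    ∈i∷j∷L : ∀ {x} → rat△ a r i x ≡ rat△ b s j x → x ∈ i ∷ j ∷ proj₁ off-poles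
    ∈i∷j∷L {x} agree = case x ≟ i , x ≟ j of λ where
      (yes x≡i , _)       → here x≡i
      (no _    , yes x≡j) → there (here x≡j)
      (no x≢i  , no x≢j)  → there (there (proj₂ (proj₂ off-poles) x≢i x≢j agree))

  module Chord {i j : F} (i≢j : i ≢ j) where

    d : F
    d = j - i

    d≢0 : d ≢ 0#
    d≢0 = x≢y⇒x-y≢0 (i≢j ∘ ≡.sym)

    point : F → F
    point t = i + t * d

    point-injective : ∀ {t t′} → point t ≡ point t′ → t ≡ t′
    point-injective {t} {t′} eq with x*y≡0⇒x≡0⊎y≡0 (≡.trans
      (solve 4 (λ i d t t′ → (t :- t′) :* d := (i :+ t :* d) :- (i :+ t′ :* d)) ≡.refl i d t t′) (x≈y⇒x∙y⁻¹≈ε eq))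
    ... | inj₁ t-t′≡0 = x∙y⁻¹≈ε⇒x≈y _ _ t-t′≡0
    ... | inj₂ d≡0    = ⊥-elim (d≢0 d≡0)

    point≢i : ∀ {t} → t ≢ 0# → point t ≢ i
    point≢i t≢0 eq = t≢0 (point-injective (≡.trans eq (solve 2 (λ i d → i := i :+ con (+ 0) :* d) ≡.refl i d)))

    point≢j : ∀ {t} → t ≢ 1# → point t ≢ j
    point≢j t≢1 eq = t≢1 (point-injective (≡.trans eq (solve 2 (λ i j → j := i :+ con (+ 1) :* (j :- i)) ≡.refl i j)))

    -- With r = (b - a) d and t² - t + 1 = 0: a + r/(t d) = b + r/((t - 1) d), as 1/t - 1/(t - 1) = 1.
    rat△-agree-at-root : ∀ {a b t} → t * t - t + 1# ≡ 0# →
                         rat△ a ((b - a) * d) i (point t) ≡ rat△ b ((b - a) * d) j (point t)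
    rat△-agree-at-root {a} {b} {t} root =
      ≡.trans (rat△-regular ≢i) (≡.trans (x∙y⁻¹≈ε⇒x≈y _ _ (vanishes₃ root
        (1-x⁻¹*x≡0 (x≢y⇒x-y≢0 ≢i)) (1-x⁻¹*x≡0 (x≢y⇒x-y≢0 ≢j))
        (solve 7 (λ a b i j t u v →
          let d = j :- i ; β = b :- a ; x = i :+ t :* d
              G = (a :+ β :* d :* u) :- (b :+ β :* d :* v)
          in G := (:- (u :* v :* d :* d :* β)) :* (t :* t :- t :+ con (+ 1))
                  :+ (G :- u :* v :* d :* d :* β :* (t :- con (+ 1))) :* (con (+ 1) :- u :* (x :- i))
                  :+ (u :* v :* d :* d :* β :* t :+ G :* u :* (x :- i)) :* (con (+ 1) :- v :* (x :- j)))
          ≡.refl a b i j t ((point t - i) ⁻¹) ((point t - j) ⁻¹))))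
        (≡.sym (rat△-regular ≢j)))
      where
      ≢i = point≢i (x²-x+1≡0⇒x≢0 root)
      ≢j = point≢j (x²-x+1≡0⇒x≢1 root)

  rat-Adj⇐ : ∀ {a b r i j} → q % 3 ≡ 1 → r ≢ 0# → (b - a) * (j - i) ≡ r → Adj (rat a r i) (rat b r j)
  rat-Adj⇐ {a} {b} {_} {i} {j} q%3≡1 r≢0 refl = agreements≡4⇒Adj (tri-rat a r i) (tri-rat b r j) π≢σ four
    where
    r = (b - a) * (j - i)
    V = rat△ a r i
    W = rat△ b r j
    i≢j : i ≢ j
    i≢j refl = r≢0 (solve 3 (λ a b i → (b :- a) :* (i :- i) := con (+ 0)) ≡.refl a b i)
    open Chord i≢j
    y,z = x²-x+1-two-roots q%3≡1
    y = proj₁ y,z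
    z = proj₁ (proj₂ y,z)
    y≢z = proj₁ (proj₂ (proj₂ y,z))
    y-root = proj₁ (proj₂ (proj₂ (proj₂ y,z)))
    z-root = proj₂ (proj₂ (proj₂ (proj₂ y,z)))
    four-points : List F
    four-points = i ∷ j ∷ point y ∷ point z ∷ []
    four-points-unique : Unique four-points
    four-points-unique =
        (i≢j ∷ (point≢i (x²-x+1≡0⇒x≢0 y-root) ∘ ≡.sym) ∷ (point≢i (x²-x+1≡0⇒x≢0 z-root) ∘ ≡.sym) ∷ [])
      ∷ ((point≢j (x²-x+1≡0⇒x≢1 y-root) ∘ ≡.sym) ∷ (point≢j (x²-x+1≡0⇒x≢1 z-root) ∘ ≡.sym) ∷ [])
      ∷ ((y≢z ∘ point-injective) ∷ [])
      ∷ [] ∷ []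
    agree-four : ∀ {x} → x ∈ four-points → V x ≡ W x
    agree-four (here refl)                         = ≡.sym (Equivalence.from (rat△-agrees-at-pole⇔ {b} {a} (i≢j ∘ ≡.sym))
      (solve 4 (λ a b i j → (a :- b) :* (i :- j) := (b :- a) :* (j :- i)) ≡.refl a b i j))
    agree-four (there (here refl))                 = Equivalence.from (rat△-agrees-at-pole⇔ i≢j) refl
    agree-four (there (there (here refl)))         = rat△-agree-at-root y-root
    agree-four (there (there (there (here refl)))) = rat△-agree-at-root z-root
    four : agreements V W ≡ 4
    four = ℕ.≤-antisym (rat△-agreements≤4 r≢0 i≢j) (agreements≥ four-points four-points-unique agree-four)
    π≢σ : ¬ (∀ p → rat a r i p ≡ rat b r j p)
    π≢σ π≗σ = fin≢∞ (≡.trans (≡.sym (rat-regular i≢j)) (≡.trans (≡.sym (π≗σ (fin i))) (rat-pole {a} {r})))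

  möb-pole : ∀ {a b c d x} → c * x + d ≡ 0# → möb a b c d (fin x) ≡ ∞
  möb-pole {c = c} {d} {x} cx+d≡0 with (c * x + d) ≟ 0#
  ... | yes _       = refl
  ... | no cx+d≢0  = ⊥-elim (cx+d≢0 cx+d≡0)

  möb-regular : ∀ {a b c d x} → c * x + d ≢ 0# → möb a b c d (fin x) ≡ fin ((a * x + b) * (c * x + d) ⁻¹)
  möb-regular {c = c} {d} {x} cx+d≢0 with (c * x + d) ≟ 0#
  ... | yes cx+d≡0 = ⊥-elim (cx+d≢0 cx+d≡0)
  ... | no _       = refl

  möb-∞-affine : ∀ {a b c d} → c ≡ 0# → möb a b c d ∞ ≡ ∞
  möb-∞-affine {c = c} c≡0 with c ≟ 0#
  ... | yes _  = refl
  ... | no c≢0 = ⊥-elim (c≢0 c≡0)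

  möb-∞ : ∀ {a b c d} → c ≢ 0# → möb a b c d ∞ ≡ fin (a * c ⁻¹)
  möb-∞ {c = c} c≢0 with c ≟ 0#
  ... | yes c≡0 = ⊥-elim (c≢0 c≡0)
  ... | no _    = refl

  data MöbiusForm (π : Pt → Pt) : Set where
    affine   : ∀ α β → α ≢ 0# → π ∞ ≡ ∞ → (∀ x → π (fin x) ≡ fin (α * x + β)) → MöbiusForm π
    rational : ∀ a r i → r ≢ 0# → (∀ p → π p ≡ rat a r i p) → MöbiusForm π

  MöbiusForm-resp : ∀ {π σ} → (∀ p → π p ≡ σ p) → MöbiusForm σ → MöbiusForm π
  MöbiusForm-resp π≗σ (affine α β α≢0 σ∞ σfin) =
    affine α β α≢0 (≡.trans (π≗σ ∞) σ∞) λ x → ≡.trans (π≗σ (fin x)) (σfin x)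
  MöbiusForm-resp π≗σ (rational a r i r≢0 σ≗) = rational a r i r≢0 λ p → ≡.trans (π≗σ p) (σ≗ p)

  möb-affine : ∀ {a b c d} → a * d ≢ b * c → c ≡ 0# → MöbiusForm (möb a b c d)
  möb-affine {a} {b} {c} {d} det≢0 refl =
    affine (a * d ⁻¹) (b * d ⁻¹) (x≢0∧y≢0⇒x*y≢0 a≢0 (⁻¹-≢0 d≢0)) (möb-∞-affine {a} {b} {0#} {d} refl) values
    where
    ad≢0 : a * d ≢ 0#
    ad≢0 ad≡0 = det≢0 (≡.trans ad≡0 (≡.sym (zeroʳ b)))
    a≢0 : a ≢ 0#
    a≢0 refl = ad≢0 (zeroˡ d)
    d≢0 : d ≢ 0#
    d≢0 refl = ad≢0 (zeroʳ a)
    0x+d≡d : ∀ x → 0# * x + d ≡ d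
    0x+d≡d x = solve 2 (λ x d → con (+ 0) :* x :+ d := d) ≡.refl x d
    values : ∀ x → möb a b 0# d (fin x) ≡ fin (a * d ⁻¹ * x + b * d ⁻¹)
    values x = ≡.trans (möb-regular (d≢0 ∘ ≡.trans (≡.sym (0x+d≡d x))))
      (cong fin (≡.trans (cong (λ e → (a * x + b) * e ⁻¹) (0x+d≡d x))
        (solve 4 (λ a b x w → (a :* x :+ b) :* w := a :* w :* x :+ b :* w) ≡.refl a b x (d ⁻¹))))

  -- (a x + b)/(c x + d) = a/c + ((b c - a d)/c²)/(x + d/c)
  möb-rational : ∀ {a b c d} → a * d ≢ b * c → c ≢ 0# → MöbiusForm (möb a b c d)
  möb-rational {a} {b} {c} {d} det≢0 c≢0 = rational (a * k) R I R≢0 values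
    where
    k = c ⁻¹
    R = (b * c - a * d) * (k * k)
    I = - (d * k)
    R≢0 : R ≢ 0#
    R≢0 = x≢0∧y≢0⇒x*y≢0 (λ e → det≢0 (≡.sym (x∙y⁻¹≈ε⇒x≈y _ _ e))) (x≢0∧y≢0⇒x*y≢0 (⁻¹-≢0 c≢0) (⁻¹-≢0 c≢0))
    1-ck≡0 : 1# - c * k ≡ 0#
    1-ck≡0 = x≈y⇒x∙y⁻¹≈ε (≡.sym (inverseʳ c c≢0))
    cx+d≢0 : ∀ {x} → x ≢ I → c * x + d ≢ 0#
    cx+d≢0 x≢I cx+d≡0 = x≢I (linear-root c≢0 cx+d≡0)
    value : ∀ {x} → x ≢ I → (a * x + b) * (c * x + d) ⁻¹ ≡ a * k + R * (x - I) ⁻¹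
    value {x} x≢I = x∙y⁻¹≈ε⇒x≈y _ _ (vanishes₃ (1-x⁻¹*x≡0 (cx+d≢0 x≢I)) (1-x⁻¹*x≡0 (x≢y⇒x-y≢0 x≢I)) 1-ck≡0
      (solve 8 (λ a b c d x k w z →
         (a :* x :+ b) :* w :- (a :* k :+ (b :* c :- a :* d) :* (k :* k) :* z)
         := (:- (a :* k) :- (b :* c :- a :* d) :* (k :* k) :* z) :* (con (+ 1) :- w :* (c :* x :+ d))
            :+ ((b :* c :- a :* d) :* (k :* k) :* c :* w) :* (con (+ 1) :- z :* (x :- (:- (d :* k))))
            :+ (w :* a :* x :+ w :* b :+ (b :* c :- a :* d) :* k :* w :- (b :* c :- a :* d) :* (k :* k) :* z :* w :* d) :* (con (+ 1) :- c :* k))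
         ≡.refl a b c d x k ((c * x + d) ⁻¹) ((x - I) ⁻¹)))
    values : ∀ p → möb a b c d p ≡ rat (a * k) R I p
    values ∞       = möb-∞ {a} {b} {c} {d} c≢0
    values (fin x) = case x ≟ I of λ where
      (yes refl) → ≡.trans (möb-pole (vanishes₁ 1-ck≡0
                     (solve 3 (λ c d k → c :* (:- (d :* k)) :+ d := d :* (con (+ 1) :- c :* k)) ≡.refl c d k)))
                   (≡.sym (rat-pole {a * k} {R}))
      (no x≢I)   → ≡.trans (möb-regular (cx+d≢0 x≢I)) (≡.trans (cong fin (value x≢I)) (≡.sym (rat-regular x≢I)))

  möbiusForm : ∀ {π} → IsPGL π → MöbiusForm π
  möbiusForm (a , b , c , d , det≢0 , π≗möb) with c ≟ 0#
  ... | yes c≡0 = MöbiusForm-resp π≗möb (möb-affine det≢0 c≡0)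
  ... | no c≢0  = MöbiusForm-resp π≗möb (möb-rational det≢0 c≢0)

  rat-IsPGL : ∀ {a r i} → r ≢ 0# → IsPGL (rat a r i)
  rat-IsPGL {a} {r} {i} r≢0 = a , r - a * i , 1# , - i , det≢0 , values
    where
    det≢0 : a * - i ≢ (r - a * i) * 1#
    det≢0 e = r≢0 (vanishes₁ (x≈y⇒x∙y⁻¹≈ε (≡.sym e))
      (solve 3 (λ a r i → r := con (+ 1) :* ((r :- a :* i) :* con (+ 1) :- a :* (:- i))) ≡.refl a r i))
    1x-i≡x-i : ∀ x → 1# * x + - i ≡ x - i
    1x-i≡x-i x = solve 2 (λ x i → con (+ 1) :* x :+ :- i := x :- i) ≡.refl x i
    a*1⁻¹≡a : a * 1# ⁻¹ ≡ a
    a*1⁻¹≡a = ≡.trans (cong (a *_) (≡.sym (⁻¹-unique (*-identityˡ 1#)))) (*-identityʳ a)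
    value : ∀ {x} → x ≢ i → (a * x + (r - a * i)) * (1# * x + - i) ⁻¹ ≡ a + r * (x - i) ⁻¹
    value {x} x≢i = ≡.trans (cong (λ e → (a * x + (r - a * i)) * e ⁻¹) (1x-i≡x-i x))
      (x∙y⁻¹≈ε⇒x≈y _ _ (vanishes₁ (1-x⁻¹*x≡0 (x≢y⇒x-y≢0 x≢i))
        (solve 5 (λ a r i x w → (a :* x :+ (r :- a :* i)) :* w :- (a :+ r :* w) := (:- a) :* (con (+ 1) :- w :* (x :- i)))
          ≡.refl a r i x ((x - i) ⁻¹))))
    values : ∀ p → rat a r i p ≡ möb a (r - a * i) 1# (- i) p
    values ∞ = ≡.sym (≡.trans (möb-∞ {a} {r - a * i} {1#} { - i} (0≢1 ∘ ≡.sym)) (cong fin a*1⁻¹≡a))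
    values (fin x) = case x ≟ i of λ where
      (yes refl) → ≡.trans (rat-pole {a} {r}) (≡.sym (möb-pole (≡.trans (1x-i≡x-i x) (-‿inverseʳ x))))
      (no x≢i)   → ≡.trans (rat-regular x≢i)
                     (≡.sym (≡.trans (möb-regular (x≢y⇒x-y≢0 x≢i ∘ ≡.trans (≡.sym (1x-i≡x-i x)))) (cong fin (value x≢i))))

  affine-TriValues : ∀ {π α β} → (∀ x → π (fin x) ≡ fin (α * x + β)) → TriValues π (λ x → α * x + β)
  affine-TriValues {π} πfin x = ≡.trans (tri-finite π (fin≢∞ ∘ ≡.trans (≡.sym (πfin x)))) (πfin x)

  rational-TriValues : ∀ {π a r i} → (∀ p → π p ≡ rat a r i p) → TriValues π (rat△ a r i)
  rational-TriValues {a = a} {r} {i} π≗rat x = ≡.trans (tri-cong π≗rat (fin x)) (tri-rat a r i x)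

  affine-agree⇒linear : ∀ {α β α′ β′ x} → α * x + β ≡ α′ * x + β′ → (α - α′) * x + (β - β′) ≡ 0#
  affine-agree⇒linear {α} {β} {α′} {β′} {x} agree = vanishes₁ (x≈y⇒x∙y⁻¹≈ε agree)
    (solve 5 (λ α β α′ β′ x → (α :- α′) :* x :+ (β :- β′) := con (+ 1) :* ((α :* x :+ β) :- (α′ :* x :+ β′))) ≡.refl α β α′ β′ x)

  affine-affine-¬Adj : ∀ {π σ α β α′ β′} → 4 ≤ q → π ∞ ≡ ∞ → (∀ x → π (fin x) ≡ fin (α * x + β)) →
                       σ ∞ ≡ ∞ → (∀ x → σ (fin x) ≡ fin (α′ * x + β′)) → ¬ Adj π σ
  affine-affine-¬Adj {π} {σ} {α} {β} {α′} {β′} 4≤q π∞ πfin σ∞ σfin with α ≟ α′ | β ≟ β′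
  ... | no α≢α′ | _ = few-agreements⇒¬Adj 4≤q (affine-TriValues {π} πfin) (affine-TriValues {σ} σfin)
    (- ((β - β′) * (α - α′) ⁻¹) ∷ []) (s≤s z≤n) λ agree → here (linear-root (x≢y⇒x-y≢0 α≢α′) (affine-agree⇒linear agree))
  ... | yes refl | no β≢β′ = few-agreements⇒¬Adj 4≤q (affine-TriValues {π} πfin) (affine-TriValues {σ} σfin) [] z≤n
    λ {x} agree → ⊥-elim (β≢β′ (x∙y⁻¹≈ε⇒x≈y _ _ (≡.trans
      (solve 4 (λ α β β′ x → β :- β′ := (α :- α) :* x :+ (β :- β′)) ≡.refl α β β′ x) (affine-agree⇒linear agree))))
  ... | yes refl | yes refl = λ adj → proj₁ adj λ where
    ∞       → ≡.trans π∞ (≡.sym σ∞)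
    (fin x) → ≡.trans (πfin x) (≡.sym (σfin x))

  affine-rational-¬Adj : ∀ {π σ α β A R I} → 4 ≤ q → α ≢ 0# → (∀ x → π (fin x) ≡ fin (α * x + β)) →
                         (∀ p → σ p ≡ rat A R I p) → ¬ Adj π σ
  affine-rational-¬Adj {π} {σ} {α} {β} {A} {R} {I} 4≤q α≢0 πfin σ≗rat =
    few-agreements⇒¬Adj 4≤q (affine-TriValues {π} πfin) (rational-TriValues σ≗rat)
      (I ∷ proj₁ roots) (s≤s (proj₁ (proj₂ roots))) ∈I∷L
    where
    roots = quadratic-roots (β - A - α * I) (- ((β - A) * I) - R) α≢0
    ∈I∷L : ∀ {x} → α * x + β ≡ rat△ A R I x → x ∈ I ∷ proj₁ roots
    ∈I∷L {x} agree = case x ≟ I of λ where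
      (yes x≡I) → here x≡I
      (no x≢I)  → there (proj₂ (proj₂ roots) (vanishes₂
        (x≈y⇒x∙y⁻¹≈ε (≡.trans agree (rat△-regular x≢I))) (1-x⁻¹*x≡0 (x≢y⇒x-y≢0 x≢I))
        (solve 7 (λ α β A R I x u → α :* x :* x :+ (β :- A :- α :* I) :* x :+ (:- ((β :- A) :* I) :- R)
           := (x :- I) :* ((α :* x :+ β) :- (A :+ R :* u)) :+ (:- R) :* (con (+ 1) :- u :* (x :- I))) ≡.refl α β A R I x ((x - I) ⁻¹))))

  affine-isolated : ∀ {π α β} → 4 ≤ q → α ≢ 0# → π ∞ ≡ ∞ → (∀ x → π (fin x) ≡ fin (α * x + β)) → Isolated π
  affine-isolated 4≤q α≢0 π∞ πfin σ σ∈PGL with möbiusForm σ∈PGL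
  ... | affine _ _ _ σ∞ σfin  = affine-affine-¬Adj 4≤q π∞ πfin σ∞ σfin
  ... | rational _ _ _ _ σ≗rat = affine-rational-¬Adj 4≤q α≢0 πfin σ≗rat

  isolated⇔∞-fixed : ∀ {π} → q % 3 ≡ 1 → 4 ≤ q → IsPGL π → Isolated π ⇔ π ∞ ≡ ∞
  isolated⇔∞-fixed {π} q%3≡1 4≤q π∈PGL with möbiusForm π∈PGL
  ... | affine α β α≢0 π∞ πfin = mk⇔ (λ _ → π∞) (λ _ → affine-isolated 4≤q α≢0 π∞ πfin)
  ... | rational A R I R≢0 π≗rat = mk⇔
    (λ isolated → ⊥-elim (isolated (rat (A + R) R (I + 1#)) (rat-IsPGL R≢0) (Adj-respˡ π≗rat (rat-Adj⇐ q%3≡1 R≢0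
      (solve 3 (λ A R I → ((A :+ R) :- A) :* ((I :+ con (+ 1)) :- I) := R) ≡.refl A R I)))))
    (λ π∞≡∞ → ⊥-elim (fin≢∞ (≡.trans (≡.sym (π≗rat ∞)) π∞≡∞)))

corollary12 : (p m q : ℕ) → Prime p → p % 2 ≡ 1 → q ≡ p ^ m → q % 3 ≡ 1 → 13 ≤ q →
    (K : FiniteField q) →
    (∀ (a b i j r s : FiniteField.F K) → r ≢ FiniteField.0# K → s ≢ FiniteField.0# K →
      (PGL.Adj K (PGL.rat K a r i) (PGL.rat K b s j)
        ⇔ (r ≡ s × FiniteField._*_ K (FiniteField._-_ K b a) (FiniteField._-_ K j i) ≡ r)))
    × (∀ (π : PGL.Pt K → PGL.Pt K) → PGL.IsPGL K π →
      (PGL.Isolated K π ⇔ π (PGL.∞ {K = K}) ≡ PGL.∞ {K = K}))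
-- Only q ≡ 1 (mod 3) and q ≥ 4 are needed; neither the characteristic nor s ≢ 0 plays a role.
corollary12 _ _ q _ _ _ q%3≡1 13≤q K =
  (λ a b i j r s r≢0 _ → mk⇔ (rat-Adj⇒ 4≤q r≢0) λ { (refl , [b-a][j-i]≡r) → rat-Adj⇐ q%3≡1 r≢0 [b-a][j-i]≡r }) ,
  (λ π π∈PGL → isolated⇔∞-fixed q%3≡1 4≤q π∈PGL)
  where
  open Contraction K
  4≤q : 4 ≤ q
  4≤q = ℕ.≤-trans (ℕ.m≤m+n 4 9) 13≤q
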